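{- Let $P\in\{0,1\}^{n\times n}$ be nonsingular such that the simplex $\mathrm{conv}\{0,\text{columns of }P\}$ is nonobtuse. If for some $v\in\{0,1\}^n$ we have $v^\top (P^\top P)^{ -1}\,\overline{v}=0$, then $v=0$, or $\overline{v}=0$, or $P^\top P$ is reducible.
   Context: $e^n$ is the all-ones vector and $\overline{v}=e^n-v$. A simplex is nonobtuse if each dihedral angle ($\pi$ minus the angle between inward normals of two facets) is at most $\pi/2$. An $n\times n$ matrix $M$ is reducible if there exist $k\in\{1,\dots,n-1\}$ and a permutation matrix $\Pi$ with $\Pi^\top M\Pi=\begin{bmatrix}M_{11}&M_{12}\\0&M_{22}\end{bmatrix}$, $M_{11}$ of size $k\times k$. -}

module Defs where

open import Data.Nat using (ℕ; zero; suc)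
import Data.Nat as ℕ
open import Data.Fin using (Fin; zero; suc; toℕ; _≟_)
open import Data.Fin.Permutation using (Permutation′; _⟨$⟩ʳ_)
open import Data.Bool using (Bool; true; false; not)
open import Data.Rational using (ℚ; 0ℚ; 1ℚ; _+_; _*_; _-_; _≤_; _<_)
open import Data.Product using (Σ; ∃; _×_; _,_)
open import Data.Sum using (_⊎_)
open import Relation.Binary.PropositionalEquality using (_≡_; _≢_)
open import Relation.Nullary using (¬_; yes; no)

Vecℚ : ℕ → Set
Vecℚ n = Fin n → ℚ

Mat : ℕ → Set
Mat n = Fin n → Fin n → ℚ

Σ[_] : ∀ {n} → (Fin n → ℚ) → ℚ
Σ[_] {zero} f = 0ℚ
Σ[_] {suc n} f = f zero + Σ[_] (λ i → f (suc i))

_·_ : ∀ {n} → Vecℚ n → Vecℚ n → ℚ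
u · w = Σ[ (λ i → u i * w i) ]

_⊗_ : ∀ {n} → Mat n → Mat n → Mat n
(A ⊗ B) i j = Σ[ (λ k → A i k * B k j) ]

transpose : ∀ {n} → Mat n → Mat n
transpose A i j = A j i

identity : ∀ {n} → Mat n
identity i j with i ≟ j
... | yes _ = 1ℚ
... | no  _ = 0ℚ

bilin : ∀ {n} → Vecℚ n → Mat n → Vecℚ n → ℚ
bilin x A y = Σ[ (λ i → Σ[ (λ j → x i * A i j * y j) ]) ]

bit : Bool → ℚ
bit true  = 1ℚ
bit false = 0ℚ

BMat : ℕ → Set
BMat n = Fin n → Fin n → Bool

BVec : ℕ → Set
BVec n = Fin n → Bool

toMat : ∀ {n} → BMat n → Mat n
toMat P i j = bit (P i j)

toVec : ∀ {n} → BVec n → Vecℚ n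
toVec v i = bit (v i)

complement : ∀ {n} → BVec n → BVec n
complement v i = not (v i)

zeroBVec : ∀ {n} → BVec n → Set
zeroBVec v = ∀ i → v i ≡ false

IsInverseₚ : ∀ {n} → Mat n → Mat n → Set
IsInverseₚ A B = (∀ i j → (A ⊗ B) i j ≡ identity i j) × (∀ i j → (B ⊗ A) i j ≡ identity i j)

Nonsingular : ∀ {n} → Mat n → Set
Nonsingular A = Σ (Mat _) (λ B → IsInverseₚ A B)

-- Simplex conv{0, columns of P}: vertices indexed by Fin (suc n),
-- vertex 0 = origin, vertex (suc j) = j-th column of P.
vertex : ∀ {n} → Mat n → Fin (suc n) → Vecℚ n
vertex P zero    = λ _ → 0ℚ
vertex P (suc j) = λ i → P i j

-- u is an inward normal of the facet opposite vertex a: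
-- orthogonal to the facet (which is spanned by the other vertices)
-- and pointing towards the opposite vertex a.
InwardNormal : ∀ {n} → Mat n → Fin (suc n) → Vecℚ n → Set
InwardNormal P a u =
  (∀ b c → b ≢ a → c ≢ a →
     u · (λ i → vertex P b i - vertex P c i) ≡ 0ℚ) ×
  (∀ b → b ≢ a → 0ℚ < u · (λ i → vertex P a i - vertex P b i))

-- Nonobtuse: every dihedral angle π − ∠(u_a, u_b) is ≤ π/2, i.e. the angle
-- between the inward normals of two distinct facets is ≥ π/2, i.e. u_a · u_b ≤ 0.
Nonobtuse : ∀ {n} → Mat n → Set
Nonobtuse P = ∀ a b → a ≢ b → ∀ u w → InwardNormal P a u → InwardNormal P b w → u · w ≤ 0ℚ

permMatrix : ∀ {n} → Permutation′ n → Mat n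
permMatrix σ i j with i ≟ (σ ⟨$⟩ʳ j)
... | yes _ = 1ℚ
... | no  _ = 0ℚ

-- Reducible: ∃ k ∈ {1..n-1} and Π with Πᵀ M Π = [[M11, M12],[0, M22]], M11 k×k
Reducible : ∀ {n} → Mat n → Set
Reducible {n} M = Σ ℕ λ k → (1 ℕ.≤ k) × (k ℕ.< n) × Σ (Permutation′ n) λ σ →
  ∀ (i j : Fin n) → k ℕ.≤ toℕ i → toℕ j ℕ.< k →
    ((transpose (permMatrix σ) ⊗ M) ⊗ permMatrix σ) i j ≡ 0ℚ

module Submission where

-- Let P be a nonsingular 0/1 matrix, Q = P⁻¹, M = PᵀP its Gram matrix and
-- G = M⁻¹.  The proof has four steps.
--
-- 1. G = QQᵀ, so G is symmetric and G i j = Q i · Q j.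
-- 2. Row i of Q is an inward normal of the facet of conv{0, columns of P}
--    opposite the vertex P e_i; nonobtuseness therefore makes every
--    off-diagonal entry of G nonpositive.
-- 3. vᵀ G v̄ is a sum of entries G i j with v i = 1, v j = 0 (hence i ≠ j),
--    all nonpositive; as it vanishes, each of them vanishes, and by symmetry
--    G has no entry between the classes {v = 1} and {v = 0}: G "splits"
--    along v.
-- 4. The inverse of a split matrix splits too, so M splits along v.  Listing
--    the indices with v = 1 first, a split M is reducible unless one of the
--    two classes is empty, i.e. unless v = 0 or v̄ = 0.

open import Defs
open import Data.Nat using (ℕ)
open import Data.Rational using (0ℚ)
open import Data.Sum using (_⊎_)
open import Relation.Binary.PropositionalEquality using (_≡_)

open import Algebra.Properties.CommutativeSemigroup using (interchange)
open import Algebra.Bundles using (CommutativeMonoid)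
import Data.Nat as ℕ
import Data.Nat.Properties as ℕ
open import Data.Bool using (true; false; not)
import Data.Bool.Properties as Bool
open import Data.Empty using (⊥-elim)
open import Data.Fin using (Fin; zero; suc; _≟_; toℕ; fromℕ; punchIn)
open import Data.Fin.Properties using (suc-injective; toℕ-fromℕ; toℕ<n)
open import Data.Fin.Permutation
  using (Permutation′; _⟨$⟩ʳ_; _⟨$⟩ˡ_; id; lift₀; insert; insert-punchIn; inverseʳ)
open import Data.Product using (_,_)
open import Data.Rational using (ℚ; 1ℚ; _+_; _*_; _-_; -_; _≤_; _<_; _<?_)
open import Data.Rational.Properties
  using ( +-identityˡ; +-identityʳ; +-inverseʳ; +-comm; +-mono-≤; +-monoʳ-≤
        ; *-identityˡ; *-identityʳ; *-zeroˡ; *-zeroʳ; *-comm; *-assoc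
        ; *-distribˡ-+; neg-distribʳ-*; neg-distrib-+; +-0-commutativeMonoid
        ; ≤-refl; ≤-antisym)
open import Data.Sum using (inj₁; inj₂)
open import Data.Unit using (tt)
open import Function using (_∘_)
open import Relation.Binary.Bundles using (Setoid)
open import Relation.Binary.PropositionalEquality
  using (_≢_; refl; sym; trans; cong; cong₂; subst; module ≡-Reasoning)
import Relation.Binary.Reasoning.Setoid as SetoidReasoning
open import Relation.Nullary using (yes; no)
open import Relation.Nullary.Decidable using (toWitness)

Σ-cong : ∀ {n} {f g : Fin n → ℚ} → (∀ i → f i ≡ g i) → Σ[ f ] ≡ Σ[ g ]
Σ-cong {ℕ.zero}  f≡g = refl
Σ-cong {ℕ.suc n} f≡g = cong₂ _+_ (f≡g zero) (Σ-cong (f≡g ∘ suc))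

Σ-zero : ∀ {n} (f : Fin n → ℚ) → (∀ i → f i ≡ 0ℚ) → Σ[ f ] ≡ 0ℚ
Σ-zero {ℕ.zero}  f f≡0 = refl
Σ-zero {ℕ.suc n} f f≡0 =
  trans (cong₂ _+_ (f≡0 zero) (Σ-zero (f ∘ suc) (f≡0 ∘ suc))) (+-identityˡ 0ℚ)

Σ-+ : ∀ {n} (f g : Fin n → ℚ) → Σ[ (λ i → f i + g i) ] ≡ Σ[ f ] + Σ[ g ]
Σ-+ {ℕ.zero}  f g = sym (+-identityˡ 0ℚ)
Σ-+ {ℕ.suc n} f g =
  trans (cong (f zero + g zero +_) (Σ-+ (f ∘ suc) (g ∘ suc)))
        (interchange (CommutativeMonoid.commutativeSemigroup +-0-commutativeMonoid)
                     (f zero) (g zero) _ _)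

Σ-*ˡ : ∀ {n} c (f : Fin n → ℚ) → c * Σ[ f ] ≡ Σ[ (λ i → c * f i) ]
Σ-*ˡ {ℕ.zero}  c f = *-zeroʳ c
Σ-*ˡ {ℕ.suc n} c f =
  trans (*-distribˡ-+ c (f zero) _) (cong (c * f zero +_) (Σ-*ˡ c (f ∘ suc)))

Σ-*ʳ : ∀ {n} c (f : Fin n → ℚ) → Σ[ f ] * c ≡ Σ[ (λ i → f i * c) ]
Σ-*ʳ c f = trans (*-comm _ c) (trans (Σ-*ˡ c f) (Σ-cong (λ i → *-comm c (f i))))

Σ-neg : ∀ {n} (f : Fin n → ℚ) → Σ[ (λ i → - f i) ] ≡ - Σ[ f ]
Σ-neg {ℕ.zero}  f = refl
Σ-neg {ℕ.suc n} f =
  trans (cong (- f zero +_) (Σ-neg (f ∘ suc))) (sym (neg-distrib-+ (f zero) _))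

Σ-swap : ∀ {m n} (f : Fin m → Fin n → ℚ) →
  Σ[ (λ i → Σ[ (λ j → f i j) ]) ] ≡ Σ[ (λ j → Σ[ (λ i → f i j) ]) ]
Σ-swap {ℕ.zero}  {n} f = sym (Σ-zero {n} (λ _ → 0ℚ) (λ _ → refl))
Σ-swap {ℕ.suc m} f =
  trans (cong (Σ[ f zero ] +_) (Σ-swap (f ∘ suc)))
        (sym (Σ-+ (f zero) (λ j → Σ[ (λ i → f (suc i) j) ])))

Σ-single : ∀ {n} (f : Fin n → ℚ) j → (∀ k → k ≢ j → f k ≡ 0ℚ) → Σ[ f ] ≡ f j
Σ-single {ℕ.suc n} f zero f≡0 =
  trans (cong (f zero +_) (Σ-zero (f ∘ suc) (λ k → f≡0 (suc k) (λ ()))))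
        (+-identityʳ (f zero))
Σ-single {ℕ.suc n} f (suc j) f≡0 =
  trans (cong₂ _+_ (f≡0 zero (λ ()))
                   (Σ-single (f ∘ suc) j (λ k k≢j → f≡0 (suc k) (k≢j ∘ suc-injective))))
        (+-identityˡ _)

Σ-nonpos : ∀ {n} (f : Fin n → ℚ) → (∀ i → f i ≤ 0ℚ) → Σ[ f ] ≤ 0ℚ
Σ-nonpos {ℕ.zero}  f f≤0 = ≤-refl
Σ-nonpos {ℕ.suc n} f f≤0 =
  subst (Σ[ f ] ≤_) (+-identityˡ 0ℚ) (+-mono-≤ (f≤0 zero) (Σ-nonpos (f ∘ suc) (f≤0 ∘ suc)))

nonpos-sum-zeroˡ : ∀ a b → a ≤ 0ℚ → b ≤ 0ℚ → a + b ≡ 0ℚ → a ≡ 0ℚ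
nonpos-sum-zeroˡ a b a≤0 b≤0 a+b≡0 =
  ≤-antisym a≤0 (subst (_≤ a) a+b≡0 (subst (a + b ≤_) (+-identityʳ a) (+-monoʳ-≤ a b≤0)))

Σ-nonpos-zero : ∀ {n} (f : Fin n → ℚ) → (∀ i → f i ≤ 0ℚ) → Σ[ f ] ≡ 0ℚ → ∀ i → f i ≡ 0ℚ
Σ-nonpos-zero {ℕ.suc n} f f≤0 Σf≡0 zero =
  nonpos-sum-zeroˡ _ _ (f≤0 zero) (Σ-nonpos (f ∘ suc) (f≤0 ∘ suc)) Σf≡0
Σ-nonpos-zero {ℕ.suc n} f f≤0 Σf≡0 (suc i) =
  Σ-nonpos-zero (f ∘ suc) (f≤0 ∘ suc) tail≡0 i
  where
  tail≡0 : Σ[ f ∘ suc ] ≡ 0ℚ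
  tail≡0 = nonpos-sum-zeroˡ _ _ (Σ-nonpos (f ∘ suc) (f≤0 ∘ suc)) (f≤0 zero)
             (trans (+-comm Σ[ f ∘ suc ] (f zero)) Σf≡0)

Σ²-nonpos-zero : ∀ {m n} (f : Fin m → Fin n → ℚ) → (∀ i j → f i j ≤ 0ℚ) →
  Σ[ (λ i → Σ[ f i ]) ] ≡ 0ℚ → ∀ i j → f i j ≡ 0ℚ
Σ²-nonpos-zero f f≤0 ΣΣf≡0 i =
  Σ-nonpos-zero (f i) (f≤0 i)
    (Σ-nonpos-zero (λ a → Σ[ f a ]) (λ a → Σ-nonpos (f a) (f≤0 a)) ΣΣf≡0 i)

·-sub : ∀ {n} (u x y : Vecℚ n) → u · (λ i → x i - y i) ≡ u · x - u · y
·-sub u x y = begin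
  Σ[ (λ i → u i * (x i - y i)) ]         ≡⟨ Σ-cong distrib ⟩
  Σ[ (λ i → u i * x i + - (u i * y i)) ] ≡⟨ Σ-+ (λ i → u i * x i) (λ i → - (u i * y i)) ⟩
  u · x + Σ[ (λ i → - (u i * y i)) ]     ≡⟨ cong (u · x +_) (Σ-neg (λ i → u i * y i)) ⟩
  u · x - u · y                          ∎
  where
  open ≡-Reasoning
  distrib : ∀ i → u i * (x i - y i) ≡ u i * x i + - (u i * y i)
  distrib i = trans (*-distribˡ-+ (u i) (x i) (- y i))
                    (cong (u i * x i +_) (sym (neg-distribʳ-* (u i) (y i))))

identity-diag : ∀ {n} (i : Fin n) → identity i i ≡ 1ℚ
identity-diag i with i ≟ i
... | yes _   = refl
... | no i≢i = ⊥-elim (i≢i refl)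

identity-offdiag : ∀ {n} {i j : Fin n} → i ≢ j → identity i j ≡ 0ℚ
identity-offdiag {i = i} {j} i≢j with i ≟ j
... | yes i≡j = ⊥-elim (i≢j i≡j)
... | no _    = refl

identity-sym : ∀ {n} (i j : Fin n) → identity i j ≡ identity j i
identity-sym i j with i ≟ j
... | yes refl = sym (identity-diag i)
... | no i≢j   = sym (identity-offdiag (i≢j ∘ sym))

infix 4 _≈_
_≈_ : ∀ {n} → Mat n → Mat n → Set
A ≈ B = ∀ i j → A i j ≡ B i j

Mat-setoid : ℕ → Setoid _ _
Mat-setoid n = record
  { Carrier       = Mat n
  ; _≈_           = _≈_
  ; isEquivalence = record
    { refl  = λ _ _ → refl
    ; sym   = λ A≈B i j → sym (A≈B i j)
    ; trans = λ A≈B B≈C i j → trans (A≈B i j) (B≈C i j)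
    }
  }

module ≈-Reasoning {n : ℕ} = SetoidReasoning (Mat-setoid n)

⊗-congˡ : ∀ {n} {A A′ : Mat n} → A ≈ A′ → (B : Mat n) → (A ⊗ B) ≈ (A′ ⊗ B)
⊗-congˡ A≈A′ B i j = Σ-cong (λ k → cong (_* B k j) (A≈A′ i k))

⊗-congʳ : ∀ {n} (A : Mat n) {B B′ : Mat n} → B ≈ B′ → (A ⊗ B) ≈ (A ⊗ B′)
⊗-congʳ A B≈B′ i j = Σ-cong (λ k → cong (A i k *_) (B≈B′ k j))

⊗-identityˡ : ∀ {n} (A : Mat n) → (identity ⊗ A) ≈ A
⊗-identityˡ A i j =
  trans (Σ-single (λ k → identity i k * A k j) i
                  (λ k k≢i → trans (cong (_* A k j) (identity-offdiag (k≢i ∘ sym))) (*-zeroˡ (A k j))))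
        (trans (cong (_* A i j) (identity-diag i)) (*-identityˡ _))

⊗-identityʳ : ∀ {n} (A : Mat n) → (A ⊗ identity) ≈ A
⊗-identityʳ A i j =
  trans (Σ-single (λ k → A i k * identity k j) j
                  (λ k k≢j → trans (cong (A i k *_) (identity-offdiag k≢j)) (*-zeroʳ (A i k))))
        (trans (cong (A i j *_) (identity-diag j)) (*-identityʳ _))

⊗-assoc : ∀ {n} (A B C : Mat n) → ((A ⊗ B) ⊗ C) ≈ (A ⊗ (B ⊗ C))
⊗-assoc A B C i j = begin
  Σ[ (λ k → Σ[ (λ l → A i l * B l k) ] * C k j) ] ≡⟨ Σ-cong (λ k → Σ-*ʳ (C k j) (λ l → A i l * B l k)) ⟩
  Σ[ (λ k → Σ[ (λ l → A i l * B l k * C k j) ]) ] ≡⟨ Σ-swap (λ k l → A i l * B l k * C k j) ⟩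
  Σ[ (λ l → Σ[ (λ k → A i l * B l k * C k j) ]) ] ≡⟨ Σ-cong (λ l → Σ-cong (λ k → *-assoc (A i l) (B l k) (C k j))) ⟩
  Σ[ (λ l → Σ[ (λ k → A i l * (B l k * C k j)) ]) ] ≡⟨ Σ-cong (λ l → Σ-*ˡ (A i l) (λ k → B l k * C k j)) ⟨
  Σ[ (λ l → A i l * Σ[ (λ k → B l k * C k j) ]) ] ∎
  where open ≡-Reasoning

transpose-⊗ : ∀ {n} (A B : Mat n) → transpose (A ⊗ B) ≈ (transpose B ⊗ transpose A)
transpose-⊗ A B i j = Σ-cong (λ k → *-comm (A j k) (B k i))

⊗-transpose-sym : ∀ {n} (A : Mat n) i j → (A ⊗ transpose A) i j ≡ (A ⊗ transpose A) j i
⊗-transpose-sym A i j = Σ-cong (λ k → *-comm (A i k) (A j k))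

inverse-unique : ∀ {n} (L A R : Mat n) → (L ⊗ A) ≈ identity → (A ⊗ R) ≈ identity → L ≈ R
inverse-unique L A R LA≈I AR≈I = begin
  L                ≈⟨ ⊗-identityʳ L ⟨
  L ⊗ identity     ≈⟨ ⊗-congʳ L AR≈I ⟨
  L ⊗ (A ⊗ R)      ≈⟨ ⊗-assoc L A R ⟨
  (L ⊗ A) ⊗ R      ≈⟨ ⊗-congˡ LA≈I R ⟩
  identity ⊗ R     ≈⟨ ⊗-identityˡ R ⟩
  R                ∎
  where open ≈-Reasoning

permMatrix-identity : ∀ {n} (σ : Permutation′ n) i j →
  permMatrix σ i j ≡ identity i (σ ⟨$⟩ʳ j)
permMatrix-identity σ i j with i ≟ σ ⟨$⟩ʳ j
... | yes _ = refl
... | no _  = refl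

permMatrix-conj : ∀ {n} (σ : Permutation′ n) (M : Mat n) i j →
  ((transpose (permMatrix σ) ⊗ M) ⊗ permMatrix σ) i j ≡ M (σ ⟨$⟩ʳ i) (σ ⟨$⟩ʳ j)
permMatrix-conj σ M i j = trans (⊗-permMatrix (transpose (permMatrix σ) ⊗ M) i j) (permMatrixᵀ-⊗ (σ ⟨$⟩ʳ j))
  where
  permMatrixᵀ-⊗ : ∀ l → (transpose (permMatrix σ) ⊗ M) i l ≡ M (σ ⟨$⟩ʳ i) l
  permMatrixᵀ-⊗ l =
    trans (Σ-cong (λ k → cong (_* M k l)
                             (trans (permMatrix-identity σ k i) (identity-sym k _))))
          (⊗-identityˡ M (σ ⟨$⟩ʳ i) l)
  ⊗-permMatrix : ∀ (A : Mat _) a b → (A ⊗ permMatrix σ) a b ≡ A a (σ ⟨$⟩ʳ b)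
  ⊗-permMatrix A a b =
    trans (Σ-cong (λ k → cong (A a k *_) (permMatrix-identity σ k b)))
          (⊗-identityʳ A a (σ ⟨$⟩ʳ b))

-- Step 1: the inverse of the Gram matrix

gram-right-inverse : ∀ {n} (P Q : Mat n) → IsInverseₚ P Q →
  ((transpose P ⊗ P) ⊗ (Q ⊗ transpose Q)) ≈ identity
gram-right-inverse P Q (PQ≈I , QP≈I) = begin
  (transpose P ⊗ P) ⊗ (Q ⊗ transpose Q)   ≈⟨ ⊗-assoc (transpose P) P (Q ⊗ transpose Q) ⟩
  transpose P ⊗ (P ⊗ (Q ⊗ transpose Q))   ≈⟨ ⊗-congʳ (transpose P) (⊗-assoc P Q _) ⟨
  transpose P ⊗ ((P ⊗ Q) ⊗ transpose Q)   ≈⟨ ⊗-congʳ (transpose P) (⊗-congˡ PQ≈I _) ⟩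
  transpose P ⊗ (identity ⊗ transpose Q)  ≈⟨ ⊗-congʳ (transpose P) (⊗-identityˡ _) ⟩
  transpose P ⊗ transpose Q               ≈⟨ transpose-⊗ Q P ⟨
  transpose (Q ⊗ P)                       ≈⟨ (λ i j → QP≈I j i) ⟩
  transpose identity                      ≈⟨ (λ i j → identity-sym j i) ⟩
  identity                                ∎
  where open ≈-Reasoning

-- Step 2: rows of P⁻¹ are inward facet normals

0<1-0 : 0ℚ < 1ℚ - 0ℚ
0<1-0 = toWitness {a? = 0ℚ <? (1ℚ - 0ℚ)} tt

-- If Q P = I, then row i of Q is an inward normal of the facet of
-- conv{0, columns of P} opposite the vertex P e_i: it is orthogonal to
-- every other vertex and has dot product 1 with P e_i.
inverse-row-inward-normal : ∀ {n} (P Q : Mat n) → (Q ⊗ P) ≈ identity →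
  ∀ i → InwardNormal P (suc i) (Q i)
inverse-row-inward-normal P Q QP≈I i = orthogonal , pointing
  where
  opposite : Q i · vertex P (suc i) ≡ 1ℚ
  opposite = trans (QP≈I i i) (identity-diag i)
  on-facet : ∀ b → b ≢ suc i → Q i · vertex P b ≡ 0ℚ
  on-facet zero    _     = Σ-zero _ (λ k → *-zeroʳ (Q i k))
  on-facet (suc j) j≢i  = trans (QP≈I i j) (identity-offdiag (j≢i ∘ cong suc ∘ sym))
  orthogonal : ∀ b c → b ≢ suc i → c ≢ suc i →
    Q i · (λ k → vertex P b k - vertex P c k) ≡ 0ℚ
  orthogonal b c b≢ c≢ =
    trans (·-sub (Q i) _ _)
          (trans (cong₂ _-_ (on-facet b b≢) (on-facet c c≢)) (+-inverseʳ 0ℚ))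
  pointing : ∀ b → b ≢ suc i → 0ℚ < Q i · (λ k → vertex P (suc i) k - vertex P b k)
  pointing b b≢ =
    subst (0ℚ <_) (sym (trans (·-sub (Q i) _ _) (cong₂ _-_ opposite (on-facet b b≢))))
          0<1-0

-- Hence, for a nonobtuse simplex, Q Qᵀ has nonpositive off-diagonal entries:
-- (Q Qᵀ) i j = Q i · Q j is the dot product of inward normals of two facets.
nonobtuse-offdiag-nonpos : ∀ {n} (P Q : Mat n) → (Q ⊗ P) ≈ identity → Nonobtuse P →
  ∀ i j → i ≢ j → (Q ⊗ transpose Q) i j ≤ 0ℚ
nonobtuse-offdiag-nonpos P Q QP≈I nonobtuse i j i≢j =
  nonobtuse (suc i) (suc j) (i≢j ∘ suc-injective) (Q i) (Q j)
            (inverse-row-inward-normal P Q QP≈I i) (inverse-row-inward-normal P Q QP≈I j)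

-- Step 3: a vanishing form vᵀ A v̄ splits A along v

-- A splits along the colouring v if it has no entry between differently
-- coloured indices; up to a permutation, A is then block diagonal.
Splits : ∀ {n} → BVec n → Mat n → Set
Splits v A = ∀ i j → v i ≢ v j → A i j ≡ 0ℚ

true≢false : true ≢ false
true≢false ()

-- vᵀ A v̄ is the sum of the entries A i j with v i = 1 and v j = 0.  If A has
-- nonpositive off-diagonal entries, all these terms are nonpositive, so a
-- vanishing form forces each of them to vanish.
cross-entries-vanish : ∀ {n} (A : Mat n) → (∀ i j → i ≢ j → A i j ≤ 0ℚ) →
  (v : BVec n) → bilin (toVec v) A (toVec (complement v)) ≡ 0ℚ →
  ∀ i j → v i ≡ true → v j ≡ false → A i j ≡ 0ℚ
cross-entries-vanish A offdiag≤0 v form≡0 i j vi vj =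
  trans (sym (term-cross i j vi vj)) (Σ²-nonpos-zero term term≤0 form≡0 i j)
  where
  term : Fin _ → Fin _ → ℚ
  term a b = toVec v a * A a b * toVec (complement v) b
  term-cross : ∀ a b → v a ≡ true → v b ≡ false → term a b ≡ A a b
  term-cross a b va vb rewrite va | vb = trans (*-identityʳ _) (*-identityˡ _)
  term≤0 : ∀ a b → term a b ≤ 0ℚ
  term≤0 a b with v a in va | v b in vb
  ... | true  | false = subst (_≤ 0ℚ) (sym (trans (*-identityʳ _) (*-identityˡ _)))
                              (offdiag≤0 a b (λ { refl → true≢false (trans (sym va) vb) }))
  ... | true  | true  = subst (_≤ 0ℚ) (sym (*-zeroʳ (1ℚ * A a b))) ≤-refl
  ... | false | w     = subst (_≤ 0ℚ) (sym (trans (cong (_* bit (not w)) (*-zeroˡ (A a b)))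
                                                 (*-zeroˡ (bit (not w))))) ≤-refl

symmetric-splits : ∀ {n} {A : Mat n} {v : BVec n} → (∀ i j → A i j ≡ A j i) →
  (∀ i j → v i ≡ true → v j ≡ false → A i j ≡ 0ℚ) → Splits v A
symmetric-splits {v = v} A-sym cross≡0 i j vi≢vj with v i in vi | v j in vj
... | true  | false = cross≡0 i j vi vj
... | false | true  = trans (A-sym i j) (cross≡0 j i vj vi)
... | true  | true  = ⊥-elim (vi≢vj refl)
... | false | false = ⊥-elim (vi≢vj refl)

-- Step 4: splitting passes to inverses, and split matrices are reducible

blockPart : ∀ {n} → BVec n → Mat n → Mat n
blockPart v A i j with v i Bool.≟ v j
... | yes _ = A i j
... | no _  = 0ℚ

blockPart-outside : ∀ {n} (v : BVec n) (A : Mat n) {i j} → v i ≢ v j → blockPart v A i j ≡ 0ℚ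
blockPart-outside v A {i} {j} vi≢vj with v i Bool.≟ v j
... | yes vi≡vj = ⊥-elim (vi≢vj vi≡vj)
... | no _      = refl

blockPart-cong : ∀ {n} (v : BVec n) {A B : Mat n} → A ≈ B → blockPart v A ≈ blockPart v B
blockPart-cong v A≈B i j with v i Bool.≟ v j
... | yes _ = A≈B i j
... | no _  = refl

blockPart-identity : ∀ {n} (v : BVec n) → blockPart v identity ≈ identity
blockPart-identity v i j with v i Bool.≟ v j
... | yes _     = refl
... | no vi≢vj = sym (identity-offdiag (vi≢vj ∘ cong v))

zero-factor : ∀ {x} y z → x ≡ 0ℚ → x * y ≡ x * z
zero-factor y z refl = trans (*-zeroˡ y) (sym (*-zeroˡ z))

split-⊗-blockPart : ∀ {n} (v : BVec n) (G A : Mat n) → Splits v G →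
  (G ⊗ blockPart v A) ≈ blockPart v (G ⊗ A)
split-⊗-blockPart v G A G-splits a b with v a Bool.≟ v b
... | yes va≡vb = Σ-cong same-term
  where
  same-term : ∀ k → G a k * blockPart v A k b ≡ G a k * A k b
  same-term k with v k Bool.≟ v b
  ... | yes _      = refl
  ... | no vk≢vb  = zero-factor _ _ (G-splits a k (λ va≡vk → vk≢vb (trans (sym va≡vk) va≡vb)))
... | no va≢vb = Σ-zero _ zero-term
  where
  zero-term : ∀ k → G a k * blockPart v A k b ≡ 0ℚ
  zero-term k with v k Bool.≟ v b
  ... | yes vk≡vb = trans (cong (_* _) (G-splits a k (λ va≡vk → va≢vb (trans va≡vk vk≡vb))))
                         (*-zeroˡ (A k b))
  ... | no _       = *-zeroʳ (G a k)

-- If G splits and is the inverse of M, then M splits: its block part is a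
-- right inverse of G, hence equal to the left inverse M.
inverse-splits : ∀ {n} (v : BVec n) (M G : Mat n) → IsInverseₚ M G → Splits v G → Splits v M
inverse-splits v M G (MG≈I , GM≈I) G-splits i j vi≢vj =
  trans (M≈blockPart i j) (blockPart-outside v M vi≢vj)
  where
  G-blockPart≈I : (G ⊗ blockPart v M) ≈ identity
  G-blockPart≈I = begin
    G ⊗ blockPart v M     ≈⟨ split-⊗-blockPart v G M G-splits ⟩
    blockPart v (G ⊗ M)   ≈⟨ blockPart-cong v GM≈I ⟩
    blockPart v identity  ≈⟨ blockPart-identity v ⟩
    identity              ∎
    where open ≈-Reasoning
  M≈blockPart : M ≈ blockPart v M
  M≈blockPart = inverse-unique M G (blockPart v M) MG≈I G-blockPart≈I

record TrueFirst {n} (v : BVec n) : Set where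
  field
    k      : ℕ
    k≤n    : k ℕ.≤ n
    σ      : Permutation′ n
    before : ∀ i → toℕ i ℕ.< k → v (σ ⟨$⟩ʳ i) ≡ true
    after  : ∀ i → k ℕ.≤ toℕ i → v (σ ⟨$⟩ʳ i) ≡ false

data LastView {n} : Fin (ℕ.suc n) → Set where
  last    : LastView (fromℕ n)
  earlier : (j : Fin n) → LastView (punchIn (fromℕ n) j)

lastView : ∀ {n} (i : Fin (ℕ.suc n)) → LastView i
lastView {ℕ.zero}  zero    = last
lastView {ℕ.suc n} zero    = earlier zero
lastView {ℕ.suc n} (suc i) with lastView i
... | last      = last
... | earlier j = earlier (suc j)

toℕ-punchIn-last : ∀ {n} (j : Fin n) → toℕ (punchIn (fromℕ n) j) ≡ toℕ j
toℕ-punchIn-last zero    = refl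
toℕ-punchIn-last (suc j) = cong ℕ.suc (toℕ-punchIn-last j)

insert-at : ∀ {m n} (i : Fin (ℕ.suc m)) (j : Fin (ℕ.suc n)) π → insert i j π ⟨$⟩ʳ i ≡ j
insert-at i j π with i ≟ i
... | yes _   = refl
... | no i≢i = ⊥-elim (i≢i refl)

-- By induction on n: a leading 1 is kept in front (lift₀), a leading 0 is
-- moved to the last position (insert).
trueFirst : ∀ {n} (v : BVec n) → TrueFirst v
trueFirst {ℕ.zero} v = record { k = 0 ; k≤n = ℕ.z≤n ; σ = id ; before = λ () ; after = λ () }
trueFirst {ℕ.suc n} v with trueFirst (v ∘ suc) | v zero in v0
... | S | true = record
  { k = ℕ.suc k ; k≤n = ℕ.s≤s k≤n ; σ = lift₀ σ ; before = before′ ; after = after′ }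
  where
  open TrueFirst S
  before′ : ∀ i → toℕ i ℕ.< ℕ.suc k → v (lift₀ σ ⟨$⟩ʳ i) ≡ true
  before′ zero    _           = v0
  before′ (suc i) (ℕ.s≤s i<k) = before i i<k
  after′ : ∀ i → ℕ.suc k ℕ.≤ toℕ i → v (lift₀ σ ⟨$⟩ʳ i) ≡ false
  after′ (suc i) (ℕ.s≤s k≤i) = after i k≤i
... | S | false = record
  { k = k ; k≤n = ℕ.m≤n⇒m≤1+n k≤n ; σ = σ′ ; before = before′ ; after = after′ }
  where
  open TrueFirst S
  σ′ : Permutation′ (ℕ.suc n)
  σ′ = insert (fromℕ n) zero σ
  before′ : ∀ i → toℕ i ℕ.< k → v (σ′ ⟨$⟩ʳ i) ≡ true
  before′ i i<k with lastView i
  ... | last      = ⊥-elim (ℕ.<⇒≱ i<k (subst (k ℕ.≤_) (sym (toℕ-fromℕ n)) k≤n))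
  ... | earlier j = trans (cong v (insert-punchIn (fromℕ n) zero σ j))
                          (before j (subst (ℕ._< k) (toℕ-punchIn-last j) i<k))
  after′ : ∀ i → k ℕ.≤ toℕ i → v (σ′ ⟨$⟩ʳ i) ≡ false
  after′ i k≤i with lastView i
  ... | last      = trans (cong v (insert-at (fromℕ n) zero σ)) v0
  ... | earlier j = trans (cong v (insert-punchIn (fromℕ n) zero σ j))
                          (after j (subst (k ℕ.≤_) (toℕ-punchIn-last j) k≤i))

constant-through : ∀ {n} (v : BVec n) (σ : Permutation′ n) b →
  (∀ i → v (σ ⟨$⟩ʳ i) ≡ b) → ∀ j → v j ≡ b
constant-through v σ b vσ≡b j = trans (cong v (sym (inverseʳ σ))) (vσ≡b (σ ⟨$⟩ˡ j))

-- A matrix splitting along v is reducible unless one colour class is empty: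
-- listing the indices with v = 1 first exhibits a zero lower-left block.
splits⇒reducible : ∀ {n} (v : BVec n) (M : Mat n) → Splits v M →
  zeroBVec v ⊎ zeroBVec (complement v) ⊎ Reducible M
splits⇒reducible {n} v M M-splits = from (trueFirst v)
  where
  from : TrueFirst v → zeroBVec v ⊎ zeroBVec (complement v) ⊎ Reducible M
  from record { k = ℕ.zero ; σ = σ ; after = after } =
    inj₁ (constant-through v σ false (λ i → after i ℕ.z≤n))
  from record { k = ℕ.suc k ; σ = σ ; before = before ; after = after } with n ℕ.≤? ℕ.suc k
  ... | yes n≤k = inj₂ (inj₁ (cong not ∘ constant-through v σ true
                                (λ i → before i (ℕ.<-≤-trans (toℕ<n i) n≤k))))
  ... | no n≰k  = inj₂ (inj₂ (ℕ.suc k , ℕ.s≤s ℕ.z≤n , ℕ.≰⇒> n≰k , σ , lower-left≡0))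
    where
    lower-left≡0 : ∀ i j → ℕ.suc k ℕ.≤ toℕ i → toℕ j ℕ.< ℕ.suc k →
      ((transpose (permMatrix σ) ⊗ M) ⊗ permMatrix σ) i j ≡ 0ℚ
    lower-left≡0 i j k≤i j<k =
      trans (permMatrix-conj σ M i j)
            (M-splits _ _ (λ eq → true≢false (trans (sym (before j j<k))
                                                  (trans (sym eq) (after i k≤i)))))

lemma2p10 : (n : ℕ) (P : BMat n) → Nonsingular (toMat P) → Nonobtuse (toMat P) →
    (G : Mat n) → IsInverseₚ (transpose (toMat P) ⊗ toMat P) G →
    (v : BVec n) → bilin (toVec v) G (toVec (complement v)) ≡ 0ℚ →
    zeroBVec v ⊎ zeroBVec (complement v) ⊎ Reducible (transpose (toMat P) ⊗ toMat P)
lemma2p10 n P (Q , PQ≈I , QP≈I) nonobtuse G (MG≈I , GM≈I) v form≡0 =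
  splits⇒reducible v M (inverse-splits v M G (MG≈I , GM≈I) G-splits)
  where
  M : Mat n
  M = transpose (toMat P) ⊗ toMat P
  G≈QQᵀ : G ≈ (Q ⊗ transpose Q)
  G≈QQᵀ = inverse-unique G M (Q ⊗ transpose Q) GM≈I (gram-right-inverse (toMat P) Q (PQ≈I , QP≈I))
  G-offdiag≤0 : ∀ i j → i ≢ j → G i j ≤ 0ℚ
  G-offdiag≤0 i j i≢j = subst (_≤ 0ℚ) (sym (G≈QQᵀ i j))
    (nonobtuse-offdiag-nonpos (toMat P) Q QP≈I nonobtuse i j i≢j)
  G-sym : ∀ i j → G i j ≡ G j i
  G-sym i j = trans (G≈QQᵀ i j) (trans (⊗-transpose-sym Q i j) (sym (G≈QQᵀ j i)))
  G-splits : Splits v G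
  G-splits = symmetric-splits G-sym (cross-entries-vanish G G-offdiag≤0 v form≡0)
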